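{- Let $n\ge 3$ be an integer and let $m$ be an integer with $1\le m\le \lfloor n/2\rfloor$. Then $T(n,m) = A(n,m) - A(n-2,m)$.
   Context: An ascending composition of a positive integer $n$ is a sequence of positive integers $\langle a_1,\dots,a_k\rangle$ with $a_1+\dots+a_k=n$ and $a_1\le\dots\le a_k$. For positive integers $m\le n$, $A(n,m)$ denotes the number of ascending compositions of $n$ whose first part satisfies $a_1\ge m$. An ascending composition is called terminal if $k=1$ or $2a_{k-1}\le a_k$. $T(n,m)$ denotes the number of terminal ascending compositions of $n$ whose first part satisfies $a_1\ge m$. -}

module Defs where

open import Data.Nat using (ℕ; zero; suc; _+_; _*_; _∸_; _≤_; _≤?_)
open import Data.List using (List; []; _∷_; map; concat; length; filter; upTo)
open import Data.List.Relation.Unary.All using (All)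
open import Data.Product using (_×_)
open import Data.Unit using (⊤)
open import Data.Sum using (_⊎_)
open import Relation.Nullary using (Dec; yes; no)
open import Relation.Nullary.Decidable using (_×-dec_; _⊎-dec_)

-- All compositions of n (ordered lists of positive integers summing to n),
-- enumerated by first part f ∈ {1,…,n}.  The fuel argument k ≥ n bounds recursion.
compsFuel : ℕ → ℕ → List (List ℕ)
compsFuel _ zero = [] ∷ []
compsFuel zero (suc n) = []
compsFuel (suc k) (suc n) =
  concat (map (λ i → map (suc i ∷_) (compsFuel k (n ∸ i))) (upTo (suc n)))

compositions : ℕ → List (List ℕ)
compositions n = compsFuel n n

data Ascending : List ℕ → Set where
  asc-nil  : Ascending []
  asc-one  : ∀ {a} → Ascending (a ∷ [])
  asc-cons : ∀ {a b l} → a ≤ b → Ascending (b ∷ l) → Ascending (a ∷ b ∷ l)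

ascending? : (l : List ℕ) → Dec (Ascending l)
ascending? [] = yes asc-nil
ascending? (a ∷ []) = yes asc-one
ascending? (a ∷ b ∷ l) with a ≤? b | ascending? (b ∷ l)
... | yes p | yes q = yes (asc-cons p q)
... | no ¬p | _ = no λ { (asc-cons p _) → ¬p p }
... | yes _ | no ¬q = no λ { (asc-cons _ q) → ¬q q }

-- first part ≥ m (the empty list never occurs for n ≥ 1)
data FirstAtLeast (m : ℕ) : List ℕ → Set where
  first≥ : ∀ {a l} → m ≤ a → FirstAtLeast m (a ∷ l)

firstAtLeast? : (m : ℕ) → (l : List ℕ) → Dec (FirstAtLeast m l)
firstAtLeast? m [] = no λ ()
firstAtLeast? m (a ∷ l) with m ≤? a
... | yes p = yes (first≥ p)
... | no ¬p = no λ { (first≥ p) → ¬p p }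

-- terminal: k = 1, or 2·a_{k-1} ≤ a_k
data Terminal : List ℕ → Set where
  term-one  : ∀ {a} → Terminal (a ∷ [])
  term-last : ∀ {a b} → 2 * a ≤ b → Terminal (a ∷ b ∷ [])
  term-cons : ∀ {a b c l} → Terminal (b ∷ c ∷ l) → Terminal (a ∷ b ∷ c ∷ l)

terminal? : (l : List ℕ) → Dec (Terminal l)
terminal? [] = no λ ()
terminal? (a ∷ []) = yes term-one
terminal? (a ∷ b ∷ []) with 2 * a ≤? b
... | yes p = yes (term-last p)
... | no ¬p = no λ { (term-last p) → ¬p p }
terminal? (a ∷ b ∷ c ∷ l) with terminal? (b ∷ c ∷ l)
... | yes p = yes (term-cons p)
... | no ¬p = no λ { (term-cons p) → ¬p p }

A : ℕ → ℕ → ℕ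
A n m = length (filter (λ l → ascending? l ×-dec firstAtLeast? m l) (compositions n))

T : ℕ → ℕ → ℕ
T n m = length (filter (λ l → (ascending? l ×-dec firstAtLeast? m l) ×-dec terminal? l) (compositions n))

module Submission where

-- Proof idea.  Classify ascending compositions by their first part.
--
-- 1. Counting along the enumeration.  The list `compositions (suc n)` is the
--    concatenation of blocks, one per first part i+1.  Hence, for any decidable
--    property P of lists, the number of compositions of n with first part ≥ m
--    satisfying P is a gated sum over first parts (countFrom-byHead), and splitting
--    off the smallest admissible first part gives the peeling recurrence
--        countFrom P n m = countFrom P n (m+1) + withHead P m (n − m),
--    where withHead P m r counts compositions ρ of r with P (m ∷ ρ).
-- 2. Tails.  m ∷ ρ is ascending iff ρ is ascending with first part ≥ m, so the
--    A-tail count is A(r,m).  For r ≥ 2m, m ∷ ρ is terminal ascending iff ρ is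
--    terminal ascending with first part ≥ m; for r < 2m it never is.
-- 3. If m ≤ n < 2m, only the one-part composition survives: A(n,m) = T(n,m) = 1.
-- 4. The identity T(n,m) + A(n−2,m) = A(n,m) for 1 ≤ m, 2m ≤ n, 3 ≤ n is proved
--    by strong induction on n − m: peel off the first part m in all three terms;
--    the parts with first part ≥ m+1 form the identity at (n, m+1), the parts with
--    first part m form the identity at (n−m, m) or an instance of (3).  The
--    boundary cases n ∈ {2m, 2m+1} follow from (3) alone.  The theorem is the
--    identity rearranged with truncated subtraction.

open import Defs
open import Data.Nat using (ℕ; zero; suc; _+_; _*_; _∸_; _≤_; _<_; _≤?_; z≤n; s≤s; s≤s⁻¹; _/_)
open import Data.Nat.Properties
open import Data.Nat.DivMod using (m/n*n≤m)
open import Data.Nat.ListAction using (sum)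
open import Data.Nat.ListAction.Properties using (sum-++)
open import Data.Nat.Induction using (<-rec)
open import Data.List using (List; []; _∷_; map; concat; length; filter; upTo; _++_; [_])
open import Data.List.Properties using (upTo-∷ʳ; map-++; map-cong; length-++; filter-++; filter-none; filter-accept)
open import Data.List.Relation.Unary.All as All using (All; []; _∷_)
open import Data.List.Relation.Unary.All.Properties using (concat⁺; map⁺)
open import Data.List.Membership.Propositional.Properties using (∈-upTo⁻)
open import Data.Product using (_×_; _,_)
open import Data.Sum using (inj₁; inj₂)
open import Data.Empty using (⊥-elim)
open import Data.Bool using (true; false)
open import Relation.Nullary using (yes; no; ¬_; does)
open import Relation.Nullary.Decidable using (_×-dec_)
open import Relation.Unary using (Pred; Decidable; ∁)
open import Relation.Binary.PropositionalEquality using (_≡_; refl; sym; trans; cong; cong₂; subst; subst₂; module ≡-Reasoning)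
open import Level using (0ℓ)
open import Algebra.Properties.CommutativeSemigroup +-commutativeSemigroup using (interchange; xy∙z≈xz∙y)

count : {X : Set} {P : Pred X 0ℓ} → Decidable P → List X → ℕ
count P? xs = length (filter P? xs)

count-++ : {X : Set} {P : Pred X 0ℓ} (P? : Decidable P) (xs ys : List X) →
  count P? (xs ++ ys) ≡ count P? xs + count P? ys
count-++ P? xs ys = trans (cong length (filter-++ P? xs ys)) (length-++ (filter P? xs))

count-concat-map : {X Y : Set} {P : Pred X 0ℓ} (P? : Decidable P) (g : Y → List X) (ys : List Y) →
  count P? (concat (map g ys)) ≡ sum (map (λ y → count P? (g y)) ys)
count-concat-map P? g [] = refl
count-concat-map P? g (y ∷ ys) =
  trans (count-++ P? (g y) (concat (map g ys))) (cong (count P? (g y) +_) (count-concat-map P? g ys))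

count-map : {X Y : Set} {P : Pred X 0ℓ} (P? : Decidable P) (f : Y → X) (ys : List Y) →
  count P? (map f ys) ≡ count (λ y → P? (f y)) ys
count-map P? f [] = refl
count-map P? f (y ∷ ys) with does (P? (f y))
... | true  = cong suc (count-map P? f ys)
... | false = count-map P? f ys

count-cong : {X : Set} {P Q : Pred X 0ℓ} (P? : Decidable P) (Q? : Decidable Q) (xs : List X) →
  All (λ x → (P x → Q x) × (Q x → P x)) xs → count P? xs ≡ count Q? xs
count-cong P? Q? [] [] = refl
count-cong P? Q? (x ∷ xs) ((P⇒Q , Q⇒P) ∷ rest) with P? x | Q? x
... | yes _ | yes _ = cong suc (count-cong P? Q? xs rest)
... | no  _ | no  _ = count-cong P? Q? xs rest
... | yes p | no ¬q = ⊥-elim (¬q (P⇒Q p))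
... | no ¬p | yes q = ⊥-elim (¬p (Q⇒P q))

count-none : {X : Set} {P : Pred X 0ℓ} (P? : Decidable P) (xs : List X) →
  All (∁ P) xs → count P? xs ≡ 0
count-none P? xs none = cong length (filter-none P? none)

-- Sums over first parts 1,…,N in which only the parts i+1 ≥ m are admitted.

gate : ℕ → (ℕ → ℕ) → ℕ → ℕ
gate m c i with m ≤? suc i
... | yes _ = c i
... | no  _ = 0

gate-open : ∀ {m i} (c : ℕ → ℕ) → m ≤ suc i → gate m c i ≡ c i
gate-open {m} {i} c m≤1+i with m ≤? suc i
... | yes _   = refl
... | no  m≰1+i = ⊥-elim (m≰1+i m≤1+i)

gate-shut : ∀ {m i} (c : ℕ → ℕ) → suc i < m → gate m c i ≡ 0
gate-shut {m} {i} c 1+i<m with m ≤? suc i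
... | yes m≤1+i = ⊥-elim (<⇒≱ 1+i<m m≤1+i)
... | no  _ = refl

gatedSum : ℕ → (ℕ → ℕ) → ℕ → ℕ
gatedSum m c N = sum (map (gate m c) (upTo N))

gatedSum-snoc : ∀ m c N → gatedSum m c (suc N) ≡ gatedSum m c N + gate m c N
gatedSum-snoc m c N = begin
    sum (map (gate m c) (upTo (suc N)))
  ≡⟨ cong (λ l → sum (map (gate m c) l)) (sym (upTo-∷ʳ N)) ⟩
    sum (map (gate m c) (upTo N ++ [ N ]))
  ≡⟨ cong sum (map-++ (gate m c) (upTo N) [ N ]) ⟩
    sum (map (gate m c) (upTo N) ++ [ gate m c N ])
  ≡⟨ sum-++ (map (gate m c) (upTo N)) [ gate m c N ] ⟩
    gatedSum m c N + (gate m c N + 0)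
  ≡⟨ cong (gatedSum m c N +_) (+-identityʳ _) ⟩
    gatedSum m c N + gate m c N ∎
  where open ≡-Reasoning

gatedSum-vanish : ∀ m c N → N < m → gatedSum m c N ≡ 0
gatedSum-vanish m c zero    _   = refl
gatedSum-vanish m c (suc N) N<m = trans (gatedSum-snoc m c N)
  (cong₂ _+_ (gatedSum-vanish m c N (<-trans (n<1+n N) N<m)) (gate-shut c N<m))

gatedSum-peel : ∀ j c N → j < N → gatedSum (suc j) c N ≡ gatedSum (suc (suc j)) c N + c j
gatedSum-peel j c (suc N) j<1+N with m≤n⇒m<n∨m≡n (s≤s⁻¹ j<1+N)
... | inj₂ refl = begin
    gatedSum (suc j) c (suc j)
  ≡⟨ gatedSum-snoc (suc j) c j ⟩
    gatedSum (suc j) c j + gate (suc j) c j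
  ≡⟨ cong₂ _+_ (gatedSum-vanish (suc j) c j ≤-refl) (gate-open c ≤-refl) ⟩
    c j
  ≡⟨ cong (_+ c j) (sym (trans (gatedSum-snoc (suc (suc j)) c j)
       (cong₂ _+_ (gatedSum-vanish (suc (suc j)) c j (<-trans (n<1+n j) (n<1+n (suc j)))) (gate-shut {suc (suc j)} {j} c ≤-refl)))) ⟩
    gatedSum (suc (suc j)) c (suc j) + c j ∎
  where open ≡-Reasoning
... | inj₁ j<N = begin
    gatedSum (suc j) c (suc N)
  ≡⟨ gatedSum-snoc (suc j) c N ⟩
    gatedSum (suc j) c N + gate (suc j) c N
  ≡⟨ cong₂ _+_ (gatedSum-peel j c N j<N) (gate-open c (m≤n⇒m≤1+n j<N)) ⟩
    gatedSum (suc (suc j)) c N + c j + c N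
  ≡⟨ xy∙z≈xz∙y (gatedSum (suc (suc j)) c N) (c j) (c N) ⟩
    gatedSum (suc (suc j)) c N + c N + c j
  ≡⟨ cong (λ x → gatedSum (suc (suc j)) c N + x + c j) (sym (gate-open c (s≤s j<N))) ⟩
    gatedSum (suc (suc j)) c N + gate (suc (suc j)) c N + c j
  ≡⟨ cong (_+ c j) (sym (gatedSum-snoc (suc (suc j)) c N)) ⟩
    gatedSum (suc (suc j)) c (suc N) + c j ∎
  where open ≡-Reasoning

compsFuel-sum : ∀ k r → All (λ ρ → sum ρ ≡ r) (compsFuel k r)
compsFuel-sum _       zero    = refl ∷ []
compsFuel-sum zero    (suc n) = []
compsFuel-sum (suc k) (suc n) = concat⁺ (map⁺ (All.tabulate λ {i} i∈ →
  map⁺ (All.map (λ sum≡ → cong suc (trans (cong (i +_) sum≡) (m+[n∸m]≡n (s≤s⁻¹ (∈-upTo⁻ i∈)))))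
    (compsFuel-sum k (n ∸ i)))))

compsFuel-irrelevant : ∀ k k' r → r ≤ k → r ≤ k' → compsFuel k r ≡ compsFuel k' r
compsFuel-irrelevant _       _        zero    _         _          = refl
compsFuel-irrelevant (suc k) (suc k') (suc n) (s≤s n≤k) (s≤s n≤k') =
  cong concat (map-cong (λ i → cong (map (suc i ∷_))
    (compsFuel-irrelevant k k' (n ∸ i) (≤-trans (m∸n≤m n i) n≤k) (≤-trans (m∸n≤m n i) n≤k')))
    (upTo (suc n)))

compositions-sum : ∀ r → All (λ ρ → sum ρ ≡ r) (compositions r)
compositions-sum r = compsFuel-sum r r

countFrom : {P : Pred (List ℕ) 0ℓ} → Decidable P → ℕ → ℕ → ℕ
countFrom P? n m = count (λ l → P? l ×-dec firstAtLeast? m l) (compositions n)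

withHead : {P : Pred (List ℕ) 0ℓ} → Decidable P → ℕ → ℕ → ℕ
withHead P? a r = count (λ ρ → P? (a ∷ ρ)) (compositions r)

module _ {P : Pred (List ℕ) 0ℓ} (P? : Decidable P) where

  blockCount : ℕ → ℕ → ℕ
  blockCount n i = count (λ ρ → P? (suc i ∷ ρ)) (compsFuel n (n ∸ i))

  countFrom-byHead : ∀ n m → countFrom P? (suc n) m ≡ gatedSum m (blockCount n) (suc n)
  countFrom-byHead n m =
    trans (count-concat-map Q? block (upTo (suc n))) (cong sum (map-cong perBlock (upTo (suc n))))
    where
    Q? : Decidable (λ l → P l × FirstAtLeast m l)
    Q? l = P? l ×-dec firstAtLeast? m l
    block : ℕ → List (List ℕ)
    block i = map (suc i ∷_) (compsFuel n (n ∸ i))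
    perBlock : ∀ i → count Q? (block i) ≡ gate m (blockCount n) i
    perBlock i with m ≤? suc i
    ... | yes m≤ = trans (count-map Q? (suc i ∷_) (compsFuel n (n ∸ i)))
          (count-cong _ _ (compsFuel n (n ∸ i)) (All.universal (λ ρ → (λ (p , _) → p) , λ p → p , first≥ m≤) _))
    ... | no m≰ = trans (count-map Q? (suc i ∷_) (compsFuel n (n ∸ i)))
          (count-none _ (compsFuel n (n ∸ i)) (All.universal (λ { ρ (_ , first≥ m≤) → m≰ m≤ }) _))

  countFrom-vanish : ∀ n m → suc n < m → countFrom P? (suc n) m ≡ 0
  countFrom-vanish n m n<m = trans (countFrom-byHead n m) (gatedSum-vanish m (blockCount n) (suc n) n<m)

  countFrom-peel : ∀ {m r n} → 1 ≤ m → n ≡ m + r →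
    countFrom P? n m ≡ countFrom P? n (suc m) + withHead P? m r
  countFrom-peel {suc j} {r} _ refl = begin
      countFrom P? (suc (j + r)) (suc j)
    ≡⟨ countFrom-byHead (j + r) (suc j) ⟩
      gatedSum (suc j) (blockCount (j + r)) (suc (j + r))
    ≡⟨ gatedSum-peel j (blockCount (j + r)) (suc (j + r)) (s≤s (m≤m+n j r)) ⟩
      gatedSum (suc (suc j)) (blockCount (j + r)) (suc (j + r)) + blockCount (j + r) j
    ≡⟨ cong₂ _+_ (sym (countFrom-byHead (j + r) (suc (suc j)))) blockIsTail ⟩
      countFrom P? (suc (j + r)) (suc (suc j)) + withHead P? (suc j) r ∎
    where
    open ≡-Reasoning
    blockIsTail : blockCount (j + r) j ≡ withHead P? (suc j) r
    blockIsTail = cong (count (λ ρ → P? (suc j ∷ ρ)))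
      (trans (cong (compsFuel (j + r)) (m+n∸m≡n j r)) (compsFuel-irrelevant (j + r) r r (m≤n+m r j) ≤-refl))

  -- The only composition of 0 is the empty one.
  withHead-nil : ∀ {a} → P (a ∷ []) → withHead P? a 0 ≡ 1
  withHead-nil p = cong length (filter-accept (λ ρ → P? (_ ∷ ρ)) p)

  withHead-low : (∀ {l} → P l → Ascending l) → ∀ {a r} → 1 ≤ r → r < a → withHead P? a r ≡ 0
  withHead-low asc {a} {r} 1≤r r<a = count-none _ (compositions r) (All.map noTail (compositions-sum r))
    where
    noTail : ∀ {ρ} → sum ρ ≡ r → ¬ P (a ∷ ρ)
    noTail {[]}    refl _  = <⇒≱ 1≤r z≤n
    noTail {b ∷ l} refl p with asc p
    ... | asc-cons a≤b _ = <⇒≱ r<a (≤-trans a≤b (m≤m+n b (sum l)))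

  countFrom-single : (∀ {l} → P l → Ascending l) → (∀ a → P (a ∷ [])) →
    ∀ m d → 1 ≤ m → d < m → countFrom P? (m + d) m ≡ 1
  countFrom-single asc one (suc j) zero 1≤m _ = begin
      countFrom P? (suc j + 0) (suc j)
    ≡⟨ countFrom-peel 1≤m refl ⟩
      countFrom P? (suc j + 0) (suc (suc j)) + withHead P? (suc j) 0
    ≡⟨ cong₂ _+_ (countFrom-vanish (j + 0) (suc (suc j)) (s≤s (s≤s (≤-reflexive (+-identityʳ j)))))
                 (withHead-nil (one (suc j))) ⟩
      1 ∎
    where open ≡-Reasoning
  countFrom-single asc one m (suc d) 1≤m 1+d<m = begin
      countFrom P? (m + suc d) m
    ≡⟨ countFrom-peel 1≤m refl ⟩
      countFrom P? (m + suc d) (suc m) + withHead P? m (suc d)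
    ≡⟨ cong₂ _+_ (cong (λ n → countFrom P? n (suc m)) (+-suc m d)) (withHead-low asc (s≤s z≤n) 1+d<m) ⟩
      countFrom P? (suc m + d) (suc m) + 0
    ≡⟨ cong (_+ 0) (countFrom-single asc one (suc m) d (s≤s z≤n) d<1+m) ⟩
      1 ∎
    where
    open ≡-Reasoning
    d<1+m : d < suc m
    d<1+m = <-trans (<-trans (n<1+n d) 1+d<m) (n<1+n m)

  countFrom-one : (∀ {l} → P l → Ascending l) → (∀ a → P (a ∷ [])) →
    ∀ {m n} → 1 ≤ m → m ≤ n → n < m + m → countFrom P? n m ≡ 1
  countFrom-one asc one {m} {n} 1≤m m≤n n<2m =
    subst (λ k → countFrom P? k m ≡ 1) (m+[n∸m]≡n m≤n) (countFrom-single asc one m (n ∸ m) 1≤m n∸m<m)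
    where
    n∸m<m : n ∸ m < m
    n∸m<m = subst (n ∸ m <_) (m+n∸m≡n m m) (∸-monoˡ-< n<2m m≤n)

AscTerm : Pred (List ℕ) 0ℓ
AscTerm l = Ascending l × Terminal l

ascTerm? : Decidable AscTerm
ascTerm? l = ascending? l ×-dec terminal? l

-- T counts AscTerm with first part ≥ m; only the conjunction is reassociated.
T-countFrom : ∀ n m → T n m ≡ countFrom ascTerm? n m
T-countFrom n m = count-cong _ _ (compositions n) (All.universal reassoc (compositions n))
  where
  reassoc : ∀ l → ((Ascending l × FirstAtLeast m l) × Terminal l → AscTerm l × FirstAtLeast m l)
                × (AscTerm l × FirstAtLeast m l → (Ascending l × FirstAtLeast m l) × Terminal l)
  reassoc l = (λ ((a , f) , t) → (a , t) , f) , (λ ((a , t) , f) → (a , f) , t)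

A-one : ∀ {m n} → 1 ≤ m → m ≤ n → n < m + m → A n m ≡ 1
A-one = countFrom-one ascending? (λ asc → asc) (λ _ → asc-one)

T-one : ∀ {m n} → 1 ≤ m → m ≤ n → n < m + m → T n m ≡ 1
T-one {m} {n} 1≤m m≤n n<2m = trans (T-countFrom n m)
  (countFrom-one ascTerm? (λ (asc , _) → asc) (λ _ → asc-one , term-one) 1≤m m≤n n<2m)

-- Tails.  m ∷ ρ is ascending iff ρ is ascending with first part ≥ m (ρ ≠ []).
withHead-ascending : ∀ m r → withHead ascending? m (suc r) ≡ A (suc r) m
withHead-ascending m r = count-cong _ _ (compositions (suc r)) (All.map tail (compositions-sum (suc r)))
  where
  tail : ∀ {ρ} → sum ρ ≡ suc r →
    (Ascending (m ∷ ρ) → Ascending ρ × FirstAtLeast m ρ) × (Ascending ρ × FirstAtLeast m ρ → Ascending (m ∷ ρ))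
  tail {b ∷ l} _ = (λ { (asc-cons m≤b asc) → asc , first≥ m≤b }) , (λ { (asc , first≥ m≤b) → asc-cons m≤b asc })

-- For r ≥ 2m the last two parts of m ∷ ρ lie in ρ, or ρ = [r] with 2m ≤ r:
-- m ∷ ρ is terminal ascending iff ρ is, with first part ≥ m.
withHead-terminal : ∀ {m r} → 1 ≤ m → m + m ≤ r → withHead ascTerm? m r ≡ countFrom ascTerm? r m
withHead-terminal {m} {r} 1≤m 2m≤r =
  count-cong _ _ (compositions r) (All.map tail (compositions-sum r))
  where
  tail : ∀ {ρ} → sum ρ ≡ r →
    (AscTerm (m ∷ ρ) → AscTerm ρ × FirstAtLeast m ρ) × (AscTerm ρ × FirstAtLeast m ρ → AscTerm (m ∷ ρ))
  tail {[]} refl = ⊥-elim (<⇒≱ (≤-trans 1≤m (m≤m+n m m)) 2m≤r)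
  tail {b ∷ []} refl =
      (λ { (asc-cons m≤b _ , _) → (asc-one , term-one) , first≥ m≤b })
    , (λ { (_ , first≥ m≤b) → asc-cons m≤b asc-one , term-last 2m≤b })
    where
    2m≤b : 2 * m ≤ b
    2m≤b = subst₂ _≤_ (cong (m +_) (sym (+-identityʳ m))) (+-identityʳ b) 2m≤r
  tail {b ∷ c ∷ l} _ =
      (λ { (asc-cons m≤b asc , term-cons t) → (asc , t) , first≥ m≤b })
    , (λ { ((asc , t) , first≥ m≤b) → asc-cons m≤b asc , term-cons t })

withHead-terminal-short : ∀ {m r} → 1 ≤ r → r < m + m → withHead ascTerm? m r ≡ 0
withHead-terminal-short {m} {r} 1≤r r<2m =
  count-none _ (compositions r) (All.map noTail (compositions-sum r))
  where
  noTail : ∀ {ρ} → sum ρ ≡ r → ¬ AscTerm (m ∷ ρ)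
  noTail {[]}        refl _ = <⇒≱ 1≤r z≤n
  noTail {b ∷ []}    refl (_ , term-last 2m≤b) =
    <⇒≱ r<2m (subst₂ _≤_ (cong (m +_) (+-identityʳ m)) (sym (+-identityʳ b)) 2m≤b)
  noTail {b ∷ c ∷ l} refl (asc-cons m≤b (asc-cons b≤c _) , _) =
    <⇒≱ r<2m (+-mono-≤ m≤b (≤-trans (≤-trans m≤b b≤c) (m≤m+n c (sum l))))

A-peel : ∀ {m r n} → 1 ≤ m → 1 ≤ r → n ≡ m + r → A n m ≡ A n (suc m) + A r m
A-peel {m} {suc r} {n} 1≤m _ n≡m+r =
  trans (countFrom-peel ascending? 1≤m n≡m+r) (cong (A n (suc m) +_) (withHead-ascending m r))

T-peel : ∀ {m r n} → 1 ≤ m → n ≡ m + r → T n m ≡ T n (suc m) + withHead ascTerm? m r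
T-peel {m} {r} {n} 1≤m n≡m+r = begin
    T n m
  ≡⟨ T-countFrom n m ⟩
    countFrom ascTerm? n m
  ≡⟨ countFrom-peel ascTerm? 1≤m n≡m+r ⟩
    countFrom ascTerm? n (suc m) + withHead ascTerm? m r
  ≡⟨ cong (_+ withHead ascTerm? m r) (sym (T-countFrom n (suc m))) ⟩
    T n (suc m) + withHead ascTerm? m r ∎
  where open ≡-Reasoning

Identity : ℕ → ℕ → Set
Identity n m = T n m + A (n ∸ 2) m ≡ A n m

-- The compositions with first part exactly m satisfy the identity one level down:
-- by the identity at (r, m) if r ≥ 2m, and since all terms are 0 or 1 otherwise.
tail-identity : ∀ {m r} → 1 ≤ m → m + 2 ≤ r → (m + m ≤ r → Identity r m) →
  withHead ascTerm? m r + A (r ∸ 2) m ≡ A r m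
tail-identity {m} {r} 1≤m m+2≤r identity with m + m ≤? r
... | yes 2m≤r = begin
    withHead ascTerm? m r + A (r ∸ 2) m
  ≡⟨ cong (_+ A (r ∸ 2) m) (withHead-terminal 1≤m 2m≤r) ⟩
    countFrom ascTerm? r m + A (r ∸ 2) m
  ≡⟨ cong (_+ A (r ∸ 2) m) (sym (T-countFrom r m)) ⟩
    T r m + A (r ∸ 2) m
  ≡⟨ identity 2m≤r ⟩
    A r m ∎
  where open ≡-Reasoning
... | no 2m≰r = begin
    withHead ascTerm? m r + A (r ∸ 2) m
  ≡⟨ cong₂ _+_ (withHead-terminal-short 1≤r r<2m) (A-one 1≤m m≤r∸2 r∸2<2m) ⟩
    1
  ≡⟨ sym (A-one 1≤m m≤r r<2m) ⟩
    A r m ∎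
  where
  open ≡-Reasoning
  r<2m : r < m + m
  r<2m = ≰⇒> 2m≰r
  m≤r : m ≤ r
  m≤r = ≤-trans (m≤m+n m 2) m+2≤r
  1≤r : 1 ≤ r
  1≤r = ≤-trans 1≤m m≤r
  m≤r∸2 : m ≤ r ∸ 2
  m≤r∸2 = m+n≤o⇒m≤o∸n m m+2≤r
  r∸2<2m : r ∸ 2 < m + m
  r∸2<2m = ≤-<-trans (m∸n≤m r 2) r<2m

-- The boundary cases n = m + r with r ∈ {m, m+1}: every term is 0 or 1.
-- For m = 1 only n = 3 remains, which is checked by evaluation.
identity-boundary : ∀ {m r n} → n ≡ m + r → 1 ≤ m → m ≤ r → r ≤ suc m → 3 ≤ n → Identity n m
identity-boundary {1} {1}         refl _ _ _ (s≤s (s≤s ()))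
identity-boundary {1} {2}         refl _ _ _ _ = refl
identity-boundary {1} {suc (suc (suc _))} _ _ _ (s≤s (s≤s ())) _
identity-boundary {m@(suc (suc k))} {r} {n} n≡m+r@refl 1≤m m≤r r≤1+m _ = begin
    T n m + A (k + r) m
  ≡⟨ cong₂ _+_ (T-peel 1≤m n≡m+r) (A-one 1≤m m≤k+r k+r<2m) ⟩
    T n (suc m) + withHead ascTerm? m r + 1
  ≡⟨ cong (_+ 1) (cong₂ _+_ (T-one (s≤s z≤n) 1+m≤n n<2[1+m]) (withHead-terminal-short 1≤r r<2m)) ⟩
    2
  ≡⟨ sym (cong₂ _+_ (A-one (s≤s z≤n) 1+m≤n n<2[1+m]) (A-one 1≤m m≤r r<2m)) ⟩
    A n (suc m) + A r m
  ≡⟨ sym (A-peel 1≤m 1≤r n≡m+r) ⟩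
    A n m ∎
  where
  open ≡-Reasoning
  1≤r : 1 ≤ r
  1≤r = ≤-trans 1≤m m≤r
  r<2m : r < m + m
  r<2m = ≤-trans (s≤s r≤1+m) (subst (_≤ m + m) (+-comm m 2) (+-monoʳ-≤ m (s≤s (s≤s z≤n))))
  1+m≤n : suc m ≤ n
  1+m≤n = m<m+n m 1≤r
  n<2[1+m] : n < suc m + suc m
  n<2[1+m] = s≤s (+-monoʳ-≤ m r≤1+m)
  m≤k+r : m ≤ k + r
  m≤k+r = ≤-trans m≤r (m≤n+m r k)
  k+r<2m : k + r < m + m
  k+r<2m = ≤-trans (s≤s (+-monoʳ-≤ k r≤1+m)) (≤-reflexive (cong suc (+-suc k m)))

-- Peeling the first part m off every term leaves the identity at (n, m+1) plus
-- the identity for the tails (tail-identity), which needs the identity at (r, m).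
identity : ∀ r {m n} → n ≡ m + r → 1 ≤ m → m ≤ r → 3 ≤ n → Identity n m
identity = <-rec Claim step
  where
  Claim : ℕ → Set
  Claim r = ∀ {m n} → n ≡ m + r → 1 ≤ m → m ≤ r → 3 ≤ n → Identity n m

  step : ∀ r → (∀ {r'} → r' < r → Claim r') → Claim r
  step r rec {m} {n} n≡m+r 1≤m m≤r 3≤n with m + 2 ≤? r
  ... | no m+2≰r = identity-boundary n≡m+r 1≤m m≤r r≤1+m 3≤n
    where
    r≤1+m : r ≤ suc m
    r≤1+m = s≤s⁻¹ (subst (r <_) (+-comm m 2) (≰⇒> m+2≰r))
  ... | yes m+2≤r = begin
      T n m + A (n ∸ 2) m
    ≡⟨ cong₂ _+_ (T-peel 1≤m n≡m+r) (A-peel 1≤m 1≤r∸2 n∸2≡m+[r∸2]) ⟩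
      (T n (suc m) + withHead ascTerm? m r) + (A (n ∸ 2) (suc m) + A (r ∸ 2) m)
    ≡⟨ interchange (T n (suc m)) (withHead ascTerm? m r) (A (n ∸ 2) (suc m)) (A (r ∸ 2) m) ⟩
      (T n (suc m) + A (n ∸ 2) (suc m)) + (withHead ascTerm? m r + A (r ∸ 2) m)
    ≡⟨ cong₂ _+_ (rec r∸1<r n≡1+m+[r∸1] (s≤s z≤n) 1+m≤r∸1 3≤n)
                 (tail-identity 1≤m m+2≤r (λ 2m≤r → rec r∸m<r r≡m+[r∸m] 1≤m (m+n≤o⇒m≤o∸n m 2m≤r) 3≤r)) ⟩
      A n (suc m) + A r m
    ≡⟨ sym (A-peel 1≤m (≤-trans 1≤m m≤r) n≡m+r) ⟩
      A n m ∎
    where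
    open ≡-Reasoning
    2≤r : 2 ≤ r
    2≤r = m+n≤o⇒n≤o m m+2≤r
    r∸1<r : r ∸ 1 < r
    r∸1<r = ∸-monoʳ-< (s≤s z≤n) (≤-trans (s≤s z≤n) 2≤r)
    r∸m<r : r ∸ m < r
    r∸m<r = ∸-monoʳ-< 1≤m m≤r
    r≡m+[r∸m] : r ≡ m + (r ∸ m)
    r≡m+[r∸m] = sym (m+[n∸m]≡n m≤r)
    n≡1+m+[r∸1] : n ≡ suc m + (r ∸ 1)
    n≡1+m+[r∸1] = trans n≡m+r (trans (cong (m +_) (sym (m+[n∸m]≡n (≤-trans (s≤s z≤n) 2≤r)))) (+-suc m (r ∸ 1)))
    n∸2≡m+[r∸2] : n ∸ 2 ≡ m + (r ∸ 2)
    n∸2≡m+[r∸2] = trans (cong (_∸ 2) n≡m+r) (+-∸-assoc m 2≤r)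
    1+m≤r∸1 : suc m ≤ r ∸ 1
    1+m≤r∸1 = m+n≤o⇒m≤o∸n (suc m) (subst (_≤ r) (+-suc m 1) m+2≤r)
    1≤r∸2 : 1 ≤ r ∸ 2
    1≤r∸2 = ≤-trans 1≤m (m+n≤o⇒m≤o∸n m m+2≤r)
    3≤r : 3 ≤ r
    3≤r = ≤-trans (+-monoˡ-≤ 2 1≤m) m+2≤r

theorem4p5 : (n m : ℕ) → 3 ≤ n → 1 ≤ m → m ≤ n / 2 →
    T n m ≡ A n m ∸ A (n ∸ 2) m
theorem4p5 n m 3≤n 1≤m m≤n/2 = begin
    T n m
  ≡⟨ sym (m+n∸n≡m (T n m) (A (n ∸ 2) m)) ⟩
    T n m + A (n ∸ 2) m ∸ A (n ∸ 2) m
  ≡⟨ cong (_∸ A (n ∸ 2) m) (identity (n ∸ m) (sym (m+[n∸m]≡n m≤n)) 1≤m (m+n≤o⇒m≤o∸n m 2m≤n) 3≤n) ⟩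
    A n m ∸ A (n ∸ 2) m ∎
  where
  open ≡-Reasoning
  2m≤n : m + m ≤ n
  2m≤n = subst (_≤ n) (trans (*-comm m 2) (cong (m +_) (+-identityʳ m)))
           (≤-trans (*-monoˡ-≤ 2 m≤n/2) (m/n*n≤m n 2))
  m≤n : m ≤ n
  m≤n = ≤-trans (m≤m+n m m) 2m≤n
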